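{- For every $n \ge 1$, if $u, v \in \mathcal{A}_n^*$ are congruent under the plactic congruence, then $\phi_n(u) = \phi_n(v)$; hence $\phi_n$ induces a monoid homomorphism $\mathsf{plac}_n \to U_n(\mathbb{T})$.
   Context: $\mathcal{A}_n = \{1 < 2 < \dots < n\}$ is an ordered alphabet and $\mathcal{A}_n^*$ its free monoid with empty word $\varepsilon$. The plactic monoid $\mathsf{plac}_n$ is the quotient of $\mathcal{A}_n^*$ by the plactic (Knuth) congruence, generated by $zxy = xzy$ for letters $x \le y < z$ and $yxz = yzx$ for letters $x < y \le z$. The tropical semiring is $\mathbb{T} = \mathbb{R} \cup \{ -\infty\}$ with $x \oplus y = \max\{x,y\}$ and $x \otimes y = x+y$; $U_n(\mathbb{T})$ is the monoid of $n\times n$ upper-triangular tropical matrices under tropical matrix multiplication. For a nonempty word $w$ and $p,q \in \{1,\dots,n\}$, $w_{pq}$ is the maximal length of a nondecreasing subsequence of $w$ with all entries in $[p,q]$ if $p \le q$, and $-\infty$ if $p > q$; $\varepsilon_{pq} = 0$ if $p = q$ and $-\infty$ otherwise. The map $\phi_n \colon \mathcal{A}_n^* \to U_n(\mathbb{T})$ is $\phi_n(w) = [w_{pq}]_{1 \le p,q \le n}$. -}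

module Defs where

open import Data.Nat using (ℕ; zero; suc; _⊔_) renaming (_+_ to _+ℕ_)
open import Data.Fin using (Fin; _≤_; _<_)
open import Data.Fin.Properties using (_≤?_; _≟_)
open import Relation.Nullary using (Dec; yes; no)
open import Data.List using (List; []; _∷_; _++_; length; map; filter; foldr; allFin)
open import Data.List.Relation.Unary.All using (All; all?)
open import Data.List.Relation.Unary.Linked using (Linked; linked?)
open import Data.Product using (_×_; _,_)
open import Relation.Nullary.Decidable using (_×-dec_)
open import Relation.Binary.PropositionalEquality using (_≡_)

-- The ordered alphabet A_n = {1 < ... < n} is modelled as Fin n with
-- its usual order; words are lists of letters; ε is [].

Word : ℕ → Set
Word n = List (Fin n)

data KnuthRel {n : ℕ} : Word n → Word n → Set where
  knuth₁ : ∀ {x y z : Fin n} → x ≤ y → y < z →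
           KnuthRel (z ∷ x ∷ y ∷ []) (x ∷ z ∷ y ∷ [])
  knuth₂ : ∀ {x y z : Fin n} → x < y → y ≤ z →
           KnuthRel (y ∷ x ∷ z ∷ []) (y ∷ z ∷ x ∷ [])

data _≡plac_ {n : ℕ} : Word n → Word n → Set where
  plac-step  : ∀ (a b : Word n) {u v : Word n} → KnuthRel u v →
               (a ++ u ++ b) ≡plac (a ++ v ++ b)
  plac-refl  : ∀ {u} → u ≡plac u
  plac-sym   : ∀ {u v} → u ≡plac v → v ≡plac u
  plac-trans : ∀ {u v w} → u ≡plac v → v ≡plac w → u ≡plac w

-- Tropical semiring elements.  All entries of φ_n(w) lie in
-- ℕ ∪ {-∞} ⊆ ℝ ∪ {-∞}, a subsemiring of 𝕋 closed under ⊕ and ⊗,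
-- so we use this subsemiring as carrier.

data Trop : Set where
  -∞  : Trop
  fin : ℕ → Trop

_⊕_ : Trop → Trop → Trop
-∞    ⊕ y     = y
x     ⊕ -∞    = x
fin a ⊕ fin b = fin (a ⊔ b)

_⊗_ : Trop → Trop → Trop
-∞    ⊗ _     = -∞
fin _ ⊗ -∞    = -∞
fin a ⊗ fin b = fin (a +ℕ b)

Mat : ℕ → Set
Mat n = Fin n → Fin n → Trop

_⊗M_ : ∀ {n} → Mat n → Mat n → Mat n
(A ⊗M B) p q = foldr (λ k acc → (A p k ⊗ B k q) ⊕ acc) -∞ (allFin _)

IdM : ∀ {n} → Mat n
IdM {n} p q with p ≟ q
... | yes _ = fin 0
... | no  _ = -∞

UpperTriangular : ∀ {n} → Mat n → Set
UpperTriangular A = ∀ p q → q < p → A p q ≡ -∞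

subseqs : ∀ {A : Set} → List A → List (List A)
subseqs []       = [] ∷ []
subseqs (x ∷ xs) = let r = subseqs xs in map (x ∷_) r ++ r

NondecIn : ∀ {n} → Fin n → Fin n → Word n → Set
NondecIn p q s = Linked _≤_ s × All (λ x → p ≤ x × x ≤ q) s

nondecIn? : ∀ {n} (p q : Fin n) (s : Word n) → Dec (NondecIn p q s)
nondecIn? p q s = linked? _≤?_ s ×-dec all? (λ x → (p ≤? x) ×-dec (x ≤? q)) s

maximum : List ℕ → ℕ
maximum = foldr _⊔_ 0

-- w_pq for a nonempty word w and p ≤ q: the maximal length of a
-- nondecreasing subsequence of w with all entries in [p, q]
-- (the empty subsequence always qualifies, so the maximum exists).
maxNondecLen : ∀ {n} → Fin n → Fin n → Word n → ℕ
maxNondecLen p q w = maximum (map length (filter (nondecIn? p q) (subseqs w)))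

φ : ∀ {n} → Word n → Mat n
φ [] p q = IdM p q
φ (a ∷ w) p q with p ≤? q
... | yes _ = fin (maxNondecLen p q (a ∷ w))
... | no  _ = -∞

_≈M_ : ∀ {n} → Mat n → Mat n → Set
A ≈M B = ∀ p q → A p q ≡ B p q

-- A longest nondecreasing subsequence of a ∷ w in [p, q] either skips a, or starts with
-- a ∈ [p, q] and continues with one of w in [a, q]; this recursion computes w_pq.
-- Unfolding it along u ++ v, a longest subsequence of u ++ v in [p, q] splits at some
-- k ∈ [p, q] into one of u in [p, k] followed by one of v in [k, q], and any such pair
-- concatenates: that is the tropical product formula φ(uv) = φ(u) ⊗ φ(v).  Since φ is
-- thus a morphism, the plactic congruence is respected as soon as the two Knuth
-- relations are, and on three-letter words the recursion checks them directly.
module Submission where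

open import Defs
open import Data.Nat as ℕ using (ℕ; _≥_; suc; _⊔_; z≤n; s≤s) renaming (_≤_ to _≤ℕ_; _+_ to _+ℕ_)
import Data.Nat.Properties as ℕ
open import Data.Fin using (Fin; _≤_; _<_)
open import Data.Fin.Properties using (_≤?_; _≟_; ≤-trans)
open import Data.List using (List; []; _∷_; _++_; map; filter; length; foldr; allFin)
open import Data.List.Properties using (filter-accept; filter-reject; filter-none; filter-++; map-++; ++-identityʳ)
open import Data.List.Relation.Unary.All.Properties using (map⁺)
open import Function using (_∘_)
open import Data.List.Relation.Unary.All as All using (All; []; _∷_)
open import Data.List.Relation.Unary.Linked using (Linked; []; [-]; _∷_; tail)
open import Data.List.Relation.Unary.Any using (here; there)
open import Data.List.Membership.Propositional using (_∈_)
open import Data.List.Membership.Propositional.Properties using (∈-++⁺ʳ; ∈-map⁺; ∈-filter⁺; ∈-allFin)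
open import Data.Product using (_×_; _,_; proj₁; proj₂; ∃)
open import Data.Sum using (inj₁; inj₂)
open import Data.Empty using (⊥-elim)
open import Relation.Nullary using (Dec; yes; no; ¬_)
open import Relation.Nullary.Decidable using (_×-dec_)
open import Relation.Binary.PropositionalEquality
open import Algebra.Properties.CommutativeSemigroup ℕ.⊔-commutativeSemigroup using (x∙yz≈y∙xz)

maximum-++ : ∀ xs ys → maximum (xs ++ ys) ≡ maximum xs ⊔ maximum ys
maximum-++ []       ys = refl
maximum-++ (x ∷ xs) ys = trans (cong (x ⊔_) (maximum-++ xs ys)) (sym (ℕ.⊔-assoc x _ _))

maximum-map-suc : ∀ {x xs} → x ∈ xs → maximum (map suc xs) ≡ suc (maximum xs)
maximum-map-suc {xs = y ∷ ys} _ = go y ys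
  where
  go : ∀ y ys → maximum (map suc (y ∷ ys)) ≡ suc (maximum (y ∷ ys))
  go y []       = cong suc (sym (ℕ.⊔-identityʳ y))
  go y (z ∷ zs) = cong (suc y ⊔_) (go z zs)

[]∈subseqs : ∀ {A : Set} (w : List A) → [] ∈ subseqs w
[]∈subseqs []       = here refl
[]∈subseqs (x ∷ xs) = ∈-++⁺ʳ (map (x ∷_) (subseqs xs)) ([]∈subseqs xs)

sucIf : ∀ {A : Set} → Dec A → ℕ → ℕ
sucIf (yes _) m = suc m
sucIf (no  _) m = 0

sucIf-yes : ∀ {A : Set} (d : Dec A) {m} → A → sucIf d m ≡ suc m
sucIf-yes (yes _) a = refl
sucIf-yes (no ¬a) a = ⊥-elim (¬a a)

sucIf-no : ∀ {A : Set} (d : Dec A) {m} → ¬ A → sucIf d m ≡ 0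
sucIf-no (yes a) ¬a = ⊥-elim (¬a a)
sucIf-no (no _)  ¬a = refl

sucIf-≤ : ∀ {A : Set} (d : Dec A) {m} → sucIf d m ≤ℕ suc m
sucIf-≤ (yes _) = ℕ.≤-refl
sucIf-≤ (no _)  = z≤n

module _ {n : ℕ} where

  InRange : Fin n → Fin n → Fin n → Set
  InRange p q a = p ≤ a × a ≤ q

  inRange? : ∀ p q a → Dec (InRange p q a)
  inRange? p q a = (p ≤? a) ×-dec (a ≤? q)

  longest : Fin n → Fin n → Word n → ℕ
  longest p q []      = 0
  longest p q (a ∷ w) = sucIf (inRange? p q a) (longest a q w) ⊔ longest p q w

  nondecIn-∷⁻ : ∀ {p q a s} → NondecIn p q (a ∷ s) → InRange p q a × NondecIn a q s
  nondecIn-∷⁻ (sorted , a∈pq ∷ s∈pq) = a∈pq , tail sorted , s∈aq sorted s∈pq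
    where
    s∈aq : ∀ {p q a s} → Linked _≤_ (a ∷ s) → All (InRange p q) s → All (InRange a q) s
    s∈aq [-]             []                = []
    s∈aq (a≤b ∷ sorted) ((_ , b≤q) ∷ s∈pq) =
      (a≤b , b≤q) ∷ All.map (λ (b≤x , x≤q) → ≤-trans a≤b b≤x , x≤q) (s∈aq sorted s∈pq)

  nondecIn-∷⁺ : ∀ {p q a s} → InRange p q a → NondecIn a q s → NondecIn p q (a ∷ s)
  nondecIn-∷⁺ {s = []}    a∈pq (_ , _)                          = [-] , a∈pq ∷ []
  nondecIn-∷⁺ {s = b ∷ s} a∈pq@(p≤a , _) (sorted , s∈aq@((a≤b , _) ∷ _)) =
    a≤b ∷ sorted , a∈pq ∷ All.map (λ (a≤x , x≤q) → ≤-trans p≤a a≤x , x≤q) s∈aq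

  nondecLengths : Fin n → Fin n → List (Word n) → List ℕ
  nondecLengths p q ss = map length (filter (nondecIn? p q) ss)

  nondecLengths-∷-in : ∀ {p q a} → InRange p q a → ∀ ss →
                       nondecLengths p q (map (a ∷_) ss) ≡ map suc (nondecLengths a q ss)
  nondecLengths-∷-in a∈pq [] = refl
  nondecLengths-∷-in {p} {q} {a} a∈pq (s ∷ ss) with nondecIn? a q s
  ... | yes s∈aq
    rewrite filter-accept (nondecIn? p q) {xs = map (a ∷_) ss} (nondecIn-∷⁺ a∈pq s∈aq)
          | filter-accept (nondecIn? a q) {xs = ss} s∈aq
    = cong (suc (length s) ∷_) (nondecLengths-∷-in a∈pq ss)
  ... | no s∉aq
    rewrite filter-reject (nondecIn? p q) {xs = map (a ∷_) ss} (λ as∈pq → s∉aq (proj₂ (nondecIn-∷⁻ as∈pq)))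
          | filter-reject (nondecIn? a q) {xs = ss} s∉aq
    = nondecLengths-∷-in a∈pq ss

  nondecLengths-∷-out : ∀ {p q a} → ¬ InRange p q a → ∀ ss → nondecLengths p q (map (a ∷_) ss) ≡ []
  nondecLengths-∷-out {p} {q} a∉pq ss =
    cong (map length) (filter-none (nondecIn? p q) (map⁺ (All.universal (λ s → a∉pq ∘ proj₁ ∘ nondecIn-∷⁻) ss)))

  maxNondecLen-∷ : ∀ p q a w → maxNondecLen p q (a ∷ w)
                   ≡ maximum (nondecLengths p q (map (a ∷_) (subseqs w))) ⊔ maxNondecLen p q w
  maxNondecLen-∷ p q a w = begin
    maximum (map length (filter (nondecIn? p q) (map (a ∷_) (subseqs w) ++ subseqs w)))
      ≡⟨ cong (maximum ∘ map length) (filter-++ (nondecIn? p q) (map (a ∷_) (subseqs w)) (subseqs w)) ⟩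
    maximum (map length (filter (nondecIn? p q) (map (a ∷_) (subseqs w)) ++ filter (nondecIn? p q) (subseqs w)))
      ≡⟨ cong maximum (map-++ length (filter (nondecIn? p q) (map (a ∷_) (subseqs w))) _) ⟩
    maximum (nondecLengths p q (map (a ∷_) (subseqs w)) ++ nondecLengths p q (subseqs w))
      ≡⟨ maximum-++ (nondecLengths p q (map (a ∷_) (subseqs w))) _ ⟩
    maximum (nondecLengths p q (map (a ∷_) (subseqs w))) ⊔ maxNondecLen p q w
      ∎
    where open ≡-Reasoning

  maxNondecLen≡longest : ∀ p q w → maxNondecLen p q w ≡ longest p q w
  maxNondecLen≡longest p q []      = refl
  maxNondecLen≡longest p q (a ∷ w) with inRange? p q a
  ... | yes a∈pq = begin
    maxNondecLen p q (a ∷ w)                                           ≡⟨ maxNondecLen-∷ p q a w ⟩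
    maximum (nondecLengths p q (map (a ∷_) (subseqs w))) ⊔ maxNondecLen p q w
      ≡⟨ cong (λ l → maximum l ⊔ maxNondecLen p q w) (nondecLengths-∷-in a∈pq (subseqs w)) ⟩
    maximum (map suc (nondecLengths a q (subseqs w))) ⊔ maxNondecLen p q w
      ≡⟨ cong (_⊔ maxNondecLen p q w) (maximum-map-suc ε∈) ⟩
    suc (maxNondecLen a q w) ⊔ maxNondecLen p q w
      ≡⟨ cong₂ (λ x y → suc x ⊔ y) (maxNondecLen≡longest a q w) (maxNondecLen≡longest p q w) ⟩
    suc (longest a q w) ⊔ longest p q w                                ∎
    where
    open ≡-Reasoning
    ε∈ : 0 ∈ nondecLengths a q (subseqs w)
    ε∈ = ∈-map⁺ length (∈-filter⁺ (nondecIn? a q) ([]∈subseqs w) ([] , []))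
  ... | no a∉pq = begin
    maxNondecLen p q (a ∷ w)                                           ≡⟨ maxNondecLen-∷ p q a w ⟩
    maximum (nondecLengths p q (map (a ∷_) (subseqs w))) ⊔ maxNondecLen p q w
      ≡⟨ cong (λ l → maximum l ⊔ maxNondecLen p q w) (nondecLengths-∷-out a∉pq (subseqs w)) ⟩
    maxNondecLen p q w                                                 ≡⟨ maxNondecLen≡longest p q w ⟩
    longest p q w                                                      ∎
    where open ≡-Reasoning

  module _ (p q a : Fin n) (w : Word n) where

    longest-∷-in : InRange p q a → longest p q (a ∷ w) ≡ suc (longest a q w) ⊔ longest p q w
    longest-∷-in a∈pq = cong (_⊔ longest p q w) (sucIf-yes (inRange? p q a) a∈pq)

    longest-∷-out : ¬ InRange p q a → longest p q (a ∷ w) ≡ longest p q w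
    longest-∷-out a∉pq = cong (_⊔ longest p q w) (sucIf-no (inRange? p q a) a∉pq)

    longest-≤-∷ : longest p q w ≤ℕ longest p q (a ∷ w)
    longest-≤-∷ = ℕ.m≤n⊔m _ _

  longest-≤-length : ∀ p q w → longest p q w ≤ℕ length w
  longest-≤-length p q []      = z≤n
  longest-≤-length p q (a ∷ w) =
    ℕ.⊔-lub (ℕ.≤-trans (sucIf-≤ (inRange? p q a)) (s≤s (longest-≤-length a q w)))
            (ℕ.m≤n⇒m≤1+n (longest-≤-length p q w))

  longest-above : ∀ {a} q w → All (_< a) w → longest a q w ≡ 0
  longest-above q []      []           = refl
  longest-above q (b ∷ w) (b<a ∷ w<a) =
    trans (longest-∷-out _ q b w (λ (a≤b , _) → ℕ.<⇒≱ b<a a≤b)) (longest-above q w w<a)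

  longest-antitoneˡ : ∀ {p k} q w → p ≤ k → longest k q w ≤ℕ longest p q w
  longest-antitoneˡ q []      p≤k = z≤n
  longest-antitoneˡ {p} {k} q (a ∷ w) p≤k = ℕ.⊔-mono-≤ head (longest-antitoneˡ q w p≤k)
    where
    head : sucIf (inRange? k q a) (longest a q w) ≤ℕ sucIf (inRange? p q a) (longest a q w)
    head with inRange? k q a
    ... | yes (k≤a , a≤q) = ℕ.≤-reflexive (sym (sucIf-yes (inRange? p q a) (≤-trans p≤k k≤a , a≤q)))
    ... | no _            = z≤n

  longest-superadditive : ∀ {p k q} → p ≤ k → k ≤ q → ∀ u v →
                          longest p k u +ℕ longest k q v ≤ℕ longest p q (u ++ v)
  longest-superadditive {p} {k} {q} p≤k k≤q [] v = longest-antitoneˡ q v p≤k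
  longest-superadditive {p} {k} {q} p≤k k≤q (a ∷ u) v with inRange? p k a
  ... | no _ = ℕ.≤-trans (longest-superadditive p≤k k≤q u v) (longest-≤-∷ p q a (u ++ v))
  ... | yes (p≤a , a≤k) = begin
    (suc (longest a k u) ⊔ longest p k u) +ℕ longest k q v
      ≡⟨ ℕ.+-distribʳ-⊔ (longest k q v) (suc (longest a k u)) (longest p k u) ⟩
    suc (longest a k u +ℕ longest k q v) ⊔ (longest p k u +ℕ longest k q v)
      ≤⟨ ℕ.⊔-mono-≤ (s≤s (longest-superadditive a≤k k≤q u v)) (longest-superadditive p≤k k≤q u v) ⟩
    suc (longest a q (u ++ v)) ⊔ longest p q (u ++ v)
      ≡⟨ longest-∷-in p q a (u ++ v) (p≤a , ≤-trans a≤k k≤q) ⟨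
    longest p q (a ∷ u ++ v)
      ∎
    where open ℕ.≤-Reasoning

  longest-split : ∀ {p q} → p ≤ q → ∀ u v →
                  ∃ λ k → p ≤ k × k ≤ q × longest p q (u ++ v) ≤ℕ longest p k u +ℕ longest k q v
  longest-split {p} p≤q [] v = p , ℕ.≤-refl , p≤q , ℕ.≤-refl
  longest-split {p} {q} p≤q (a ∷ u) v with longest-split p≤q u v
  ... | k , p≤k , k≤q , bound = go (inRange? p q a)
    where
    -- either a longest subsequence of (a ∷ u ++ v) avoids a, and the split k for u ++ v works,
    -- or it starts with a, and the split k′ for the tail in [a, q] works
    skip : longest p q (u ++ v) ≤ℕ longest p k (a ∷ u) +ℕ longest k q v
    skip = ℕ.≤-trans bound (ℕ.+-monoˡ-≤ (longest k q v) (longest-≤-∷ p k a u))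
    go : Dec (InRange p q a) →
         ∃ λ k → p ≤ k × k ≤ q × longest p q (a ∷ u ++ v) ≤ℕ longest p k (a ∷ u) +ℕ longest k q v
    go (no a∉pq) = k , p≤k , k≤q , ℕ.≤-trans (ℕ.≤-reflexive (longest-∷-out p q a (u ++ v) a∉pq)) skip
    go (yes a∈pq@(p≤a , a≤q)) with longest-split a≤q u v
    ... | k′ , a≤k′ , k′≤q , bound′ with ℕ.⊔-sel (suc (longest a q (u ++ v))) (longest p q (u ++ v))
    ...   | inj₂ skips-a =
      k , p≤k , k≤q , ℕ.≤-trans (ℕ.≤-reflexive (trans (longest-∷-in p q a (u ++ v) a∈pq) skips-a)) skip
    ...   | inj₁ takes-a = k′ , ≤-trans p≤a a≤k′ , k′≤q , (begin
      longest p q (a ∷ u ++ v)                                  ≡⟨ longest-∷-in p q a (u ++ v) a∈pq ⟩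
      suc (longest a q (u ++ v)) ⊔ longest p q (u ++ v)         ≡⟨ takes-a ⟩
      suc (longest a q (u ++ v))                                ≤⟨ s≤s bound′ ⟩
      suc (longest a k′ u) +ℕ longest k′ q v
        ≤⟨ ℕ.+-monoˡ-≤ (longest k′ q v) (ℕ.m≤m⊔n _ (longest p k′ u)) ⟩
      (suc (longest a k′ u) ⊔ longest p k′ u) +ℕ longest k′ q v
        ≡⟨ cong (_+ℕ longest k′ q v) (longest-∷-in p k′ a u (p≤a , a≤k′)) ⟨
      longest p k′ (a ∷ u) +ℕ longest k′ q v                    ∎)
      where open ℕ.≤-Reasoning

  longest-swap-unless-both : ∀ p q {x z} → x < z → ¬ (InRange p q x × InRange p q z) →
                             longest p q (x ∷ z ∷ []) ≡ longest p q (z ∷ x ∷ [])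
  longest-swap-unless-both p q {x} {z} x<z ¬both = go (inRange? p q x)
    where
    open ≡-Reasoning
    go : Dec (InRange p q x) → longest p q (x ∷ z ∷ []) ≡ longest p q (z ∷ x ∷ [])
    go (no x∉pq) = begin
      longest p q (x ∷ z ∷ [])                                           ≡⟨ longest-∷-out p q x (z ∷ []) x∉pq ⟩
      sucIf (inRange? p q z) (longest z q []) ⊔ longest p q []
        ≡⟨ cong₂ (λ m m′ → sucIf (inRange? p q z) m ⊔ m′)
                 (longest-above q (x ∷ []) (x<z ∷ [])) (longest-∷-out p q x [] x∉pq) ⟨
      longest p q (z ∷ x ∷ [])                                           ∎
    go (yes x∈pq@(p≤x , _)) = begin
      longest p q (x ∷ z ∷ [])                                           ≡⟨ longest-∷-in p q x (z ∷ []) x∈pq ⟩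
      suc (longest x q (z ∷ [])) ⊔ longest p q (z ∷ [])
        ≡⟨ cong₂ (λ m m′ → suc m ⊔ m′) (longest-∷-out x q z [] (z∉pq ∘ (≤-trans p≤x (ℕ.<⇒≤ x<z) ,_) ∘ proj₂))
                                       (longest-∷-out p q z [] z∉pq) ⟩
      suc 0 ⊔ 0                                                          ≡⟨ longest-∷-in p q x [] x∈pq ⟨
      longest p q (x ∷ [])                                               ≡⟨ longest-∷-out p q z (x ∷ []) z∉pq ⟨
      longest p q (z ∷ x ∷ [])                                           ∎
      where
      z∉pq : ¬ InRange p q z
      z∉pq z∈pq = ¬both (x∈pq , z∈pq)

  longest-knuth₁ : ∀ p q {x y z} → x ≤ y → y < z →
                   longest p q (z ∷ x ∷ y ∷ []) ≡ longest p q (x ∷ z ∷ y ∷ [])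
  longest-knuth₁ p q {x} {y} {z} x≤y y<z = begin
    sucIf Rz (longest z q (x ∷ y ∷ [])) ⊔ (sucIf Rx (longest x q (y ∷ [])) ⊔ longest p q (y ∷ []))
      ≡⟨ cong (λ m → sucIf Rz m ⊔ _) (longest-above q (x ∷ y ∷ []) (ℕ.≤-<-trans x≤y y<z ∷ y<z ∷ [])) ⟩
    sucIf Rz 0 ⊔ (sucIf Rx (longest x q (y ∷ [])) ⊔ longest p q (y ∷ []))
      ≡⟨ x∙yz≈y∙xz (sucIf Rz 0) (sucIf Rx (longest x q (y ∷ []))) (longest p q (y ∷ [])) ⟩
    sucIf Rx (longest x q (y ∷ [])) ⊔ (sucIf Rz 0 ⊔ longest p q (y ∷ []))
      ≡⟨ cong₂ (λ m m′ → sucIf Rx m ⊔ (sucIf Rz m′ ⊔ _))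
               (sym xzy≡xy) (sym (longest-above q (y ∷ []) (y<z ∷ []))) ⟩
    sucIf Rx (longest x q (z ∷ y ∷ [])) ⊔ (sucIf Rz (longest z q (y ∷ [])) ⊔ longest p q (y ∷ []))
      ∎
    where
    open ≡-Reasoning
    Rx = inRange? p q x
    Rz = inRange? p q z
    -- a subsequence x z in [x, q] can be traded for x y
    z-absorbed : sucIf (inRange? x q z) 0 ≤ℕ longest x q (y ∷ [])
    z-absorbed with inRange? x q z
    ... | no _            = z≤n
    ... | yes (_ , z≤q) = ℕ.≤-reflexive (sym (longest-∷-in x q y [] (x≤y , y≤q)))
      where y≤q = ≤-trans (ℕ.<⇒≤ y<z) z≤q
    xzy≡xy : longest x q (z ∷ y ∷ []) ≡ longest x q (y ∷ [])
    xzy≡xy = trans (cong (λ m → sucIf (inRange? x q z) m ⊔ _) (longest-above q (y ∷ []) (y<z ∷ [])))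
                   (ℕ.m≤n⇒m⊔n≡n z-absorbed)

  longest-knuth₂ : ∀ p q {x y z} → x < y → y ≤ z →
                   longest p q (y ∷ x ∷ z ∷ []) ≡ longest p q (y ∷ z ∷ x ∷ [])
  longest-knuth₂ p q {x} {y} {z} x<y y≤z = begin
    sucIf Ry (longest y q (x ∷ z ∷ [])) ⊔ longest p q (x ∷ z ∷ [])
      ≡⟨ cong (λ m → sucIf Ry m ⊔ _) (longest-∷-out y q x (z ∷ []) (λ (y≤x , _) → ℕ.<⇒≱ x<y y≤x)) ⟩
    G ⊔ longest p q (x ∷ z ∷ [])
      ≡⟨ tails (inRange? p q x) (inRange? p q z) ⟩
    G ⊔ longest p q (z ∷ x ∷ [])
      ≡⟨ cong (λ m → sucIf Ry m ⊔ _) yzx≡yz ⟨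
    sucIf Ry (longest y q (z ∷ x ∷ [])) ⊔ longest p q (z ∷ x ∷ [])
      ∎
    where
    open ≡-Reasoning
    x<z = ℕ.<-≤-trans x<y y≤z
    Ry = inRange? p q y
    G  = sucIf Ry (longest y q (z ∷ []))
    yzx≡yz : longest y q (z ∷ x ∷ []) ≡ longest y q (z ∷ [])
    yzx≡yz = cong₂ (λ m m′ → sucIf (inRange? y q z) m ⊔ m′)
                   (longest-above q (x ∷ []) (x<z ∷ [])) (longest-above q (x ∷ []) (x<y ∷ []))
    -- when x and z both lie in [p, q], so does y, and y z already has the maximal length 2
    tails : Dec (InRange p q x) → Dec (InRange p q z) →
            G ⊔ longest p q (x ∷ z ∷ []) ≡ G ⊔ longest p q (z ∷ x ∷ [])
    tails (yes (p≤x , _)) (yes (_ , z≤q)) =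
      trans (ℕ.m≥n⇒m⊔n≡m (≤G x z)) (sym (ℕ.m≥n⇒m⊔n≡m (≤G z x)))
      where
      G≡2 : G ≡ 2
      G≡2 = trans (sucIf-yes Ry (≤-trans p≤x (ℕ.<⇒≤ x<y) , ≤-trans y≤z z≤q))
                  (cong suc (longest-∷-in y q z [] (y≤z , z≤q)))
      ≤G : ∀ a b → longest p q (a ∷ b ∷ []) ≤ℕ G
      ≤G a b = ℕ.≤-trans (longest-≤-length p q (a ∷ b ∷ [])) (ℕ.≤-reflexive (sym G≡2))
    tails (no x∉pq) _        = cong (G ⊔_) (longest-swap-unless-both p q x<z (x∉pq ∘ proj₁))
    tails _        (no z∉pq) = cong (G ⊔_) (longest-swap-unless-both p q x<z (z∉pq ∘ proj₂))

infix 4 _≤T_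

data _≤T_ : Trop → Trop → Set where
  -∞≤     : ∀ {y} → -∞ ≤T y
  fin≤fin : ∀ {a b} → a ≤ℕ b → fin a ≤T fin b

≤T-reflexive : ∀ {x y} → x ≡ y → x ≤T y
≤T-reflexive { -∞}   refl = -∞≤
≤T-reflexive {fin a} refl = fin≤fin ℕ.≤-refl

≤T-trans : ∀ {x y z} → x ≤T y → y ≤T z → x ≤T z
≤T-trans -∞≤         _           = -∞≤
≤T-trans (fin≤fin a) (fin≤fin b) = fin≤fin (ℕ.≤-trans a b)

≤T-antisym : ∀ {x y} → x ≤T y → y ≤T x → x ≡ y
≤T-antisym -∞≤         -∞≤         = refl
≤T-antisym (fin≤fin a) (fin≤fin b) = cong fin (ℕ.≤-antisym a b)

⊕-lub : ∀ {x y z} → x ≤T z → y ≤T z → x ⊕ y ≤T z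
⊕-lub { -∞}            _           y≤z         = y≤z
⊕-lub {fin a} { -∞}    x≤z         _           = x≤z
⊕-lub {fin a} {fin b} (fin≤fin a≤c) (fin≤fin b≤c) = fin≤fin (ℕ.⊔-lub a≤c b≤c)

x≤x⊕y : ∀ x y → x ≤T x ⊕ y
x≤x⊕y -∞      y       = -∞≤
x≤x⊕y (fin a) -∞      = ≤T-reflexive refl
x≤x⊕y (fin a) (fin b) = fin≤fin (ℕ.m≤m⊔n a b)

y≤x⊕y : ∀ x y → y ≤T x ⊕ y
y≤x⊕y -∞      y       = ≤T-reflexive refl
y≤x⊕y (fin a) -∞      = -∞≤
y≤x⊕y (fin a) (fin b) = fin≤fin (ℕ.m≤n⊔m a b)

⊗-zeroʳ : ∀ x → x ⊗ -∞ ≡ -∞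
⊗-zeroʳ -∞      = refl
⊗-zeroʳ (fin _) = refl

⊗-identityˡ : ∀ x → fin 0 ⊗ x ≡ x
⊗-identityˡ -∞      = refl
⊗-identityˡ (fin a) = refl

⊗-identityʳ : ∀ x → x ⊗ fin 0 ≡ x
⊗-identityʳ -∞      = refl
⊗-identityʳ (fin a) = cong fin (ℕ.+-identityʳ a)

⨁ : ∀ {A : Set} → (A → Trop) → List A → Trop
⨁ t = foldr (λ k acc → t k ⊕ acc) -∞

module _ {A : Set} (t : A → Trop) where

  ⨁-lub : ∀ {X} → (∀ k → t k ≤T X) → ∀ ks → ⨁ t ks ≤T X
  ⨁-lub t≤X []       = -∞≤
  ⨁-lub t≤X (k ∷ ks) = ⊕-lub (t≤X k) (⨁-lub t≤X ks)

  ⨁-upper : ∀ {k ks} → k ∈ ks → t k ≤T ⨁ t ks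
  ⨁-upper {k} (here refl)    = x≤x⊕y (t k) _
  ⨁-upper {ks = k′ ∷ _} (there k∈) = ≤T-trans (⨁-upper k∈) (y≤x⊕y (t k′) _)

  ⨁-attained : ∀ {X k ks} → (∀ k → t k ≤T X) → k ∈ ks → X ≤T t k → ⨁ t ks ≡ X
  ⨁-attained {ks = ks} t≤X k∈ X≤tk = ≤T-antisym (⨁-lub t≤X ks) (≤T-trans X≤tk (⨁-upper k∈))

⨁-cong : ∀ {A : Set} {t t′ : A → Trop} → (∀ k → t k ≡ t′ k) → ∀ ks → ⨁ t ks ≡ ⨁ t′ ks
⨁-cong t≡t′ []       = refl
⨁-cong t≡t′ (k ∷ ks) = cong₂ _⊕_ (t≡t′ k) (⨁-cong t≡t′ ks)

module _ {n : ℕ} where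

  ⊗M-congˡ : ∀ {A A′ : Mat n} (B : Mat n) → A ≈M A′ → (A ⊗M B) ≈M (A′ ⊗M B)
  ⊗M-congˡ B A≈A′ p q = ⨁-cong (λ k → cong (_⊗ B k q) (A≈A′ p k)) (allFin n)

  ⊗M-congʳ : ∀ (A : Mat n) {B B′ : Mat n} → B ≈M B′ → (A ⊗M B) ≈M (A ⊗M B′)
  ⊗M-congʳ A B≈B′ p q = ⨁-cong (λ k → cong (A p k ⊗_) (B≈B′ k q)) (allFin n)

  IdM-diagonal : ∀ (p : Fin n) → IdM p p ≡ fin 0
  IdM-diagonal p with p ≟ p
  ... | yes _  = refl
  ... | no p≢p = ⊥-elim (p≢p refl)

  ⊗M-identityˡ : ∀ (B : Mat n) → (IdM ⊗M B) ≈M B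
  ⊗M-identityˡ B p q = ⨁-attained _ bound (∈-allFin p)
    (≤T-reflexive (sym (trans (cong (_⊗ B p q) (IdM-diagonal p)) (⊗-identityˡ (B p q)))))
    where
    bound : ∀ k → IdM p k ⊗ B k q ≤T B p q
    bound k with p ≟ k
    ... | yes refl = ≤T-reflexive (⊗-identityˡ (B p q))
    ... | no _     = -∞≤

  ⊗M-identityʳ : ∀ (A : Mat n) → (A ⊗M IdM) ≈M A
  ⊗M-identityʳ A p q = ⨁-attained _ bound (∈-allFin q)
    (≤T-reflexive (sym (trans (cong (A p q ⊗_) (IdM-diagonal q)) (⊗-identityʳ (A p q)))))
    where
    bound : ∀ k → A p k ⊗ IdM k q ≤T A p q
    bound k with k ≟ q
    ... | yes refl = ≤T-reflexive (⊗-identityʳ (A p k))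
    ... | no _     = ≤T-trans (≤T-reflexive (⊗-zeroʳ (A p k))) -∞≤

  module _ (a : Fin n) (w : Word n) {p q : Fin n} where

    φ-∷-≤ : p ≤ q → φ (a ∷ w) p q ≡ fin (longest p q (a ∷ w))
    φ-∷-≤ p≤q with p ≤? q
    ... | yes _   = cong fin (maxNondecLen≡longest p q (a ∷ w))
    ... | no p≰q = ⊥-elim (p≰q p≤q)

    φ-∷-≰ : ¬ p ≤ q → φ (a ∷ w) p q ≡ -∞
    φ-∷-≰ p≰q with p ≤? q
    ... | yes p≤q = ⊥-elim (p≰q p≤q)
    ... | no _    = refl

  φ-∷-≈ : ∀ {a b : Fin n} {u v} → (∀ p q → longest p q (a ∷ u) ≡ longest p q (b ∷ v)) →
          φ (a ∷ u) ≈M φ (b ∷ v)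
  φ-∷-≈ {a} {b} {u} {v} same p q with p ≤? q
  ... | yes _ = cong fin (trans (maxNondecLen≡longest p q (a ∷ u))
                                (trans (same p q) (sym (maxNondecLen≡longest p q (b ∷ v)))))
  ... | no _  = refl

  φ-++-∷ : ∀ a u b (v : Word n) → φ ((a ∷ u) ++ (b ∷ v)) ≈M (φ (a ∷ u) ⊗M φ (b ∷ v))
  φ-++-∷ a u b v p q = sym (⨁-attained _ (λ k → bound k (p ≤? k) (k ≤? q)) (∈-allFin k₀) attained)
    where
    U = a ∷ u
    V = b ∷ v
    bound : ∀ k → Dec (p ≤ k) → Dec (k ≤ q) → φ U p k ⊗ φ V k q ≤T φ (U ++ V) p q
    bound k (yes p≤k) (yes k≤q)
      rewrite φ-∷-≤ a u p≤k | φ-∷-≤ b v k≤q | φ-∷-≤ a (u ++ V) (≤-trans p≤k k≤q)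
      = fin≤fin (longest-superadditive p≤k k≤q U V)
    bound k _         (no k≰q) rewrite φ-∷-≰ b v k≰q | ⊗-zeroʳ (φ U p k) = -∞≤
    bound k (no p≰k)  _        rewrite φ-∷-≰ a u p≰k = -∞≤
    split : Dec (p ≤ q) → ∃ λ k → φ (U ++ V) p q ≤T φ U p k ⊗ φ V k q
    split (no p≰q) = p , ≤T-trans (≤T-reflexive (φ-∷-≰ a (u ++ V) p≰q)) -∞≤
    split (yes p≤q) with longest-split p≤q U V
    ... | k , p≤k , k≤q , longest≤ =
      k , ≤T-trans (≤T-reflexive (φ-∷-≤ a (u ++ V) p≤q))
                   (≤T-trans (fin≤fin longest≤) (≤T-reflexive (sym (cong₂ _⊗_ (φ-∷-≤ a u p≤k) (φ-∷-≤ b v k≤q)))))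
    k₀ = proj₁ (split (p ≤? q))
    attained : φ (U ++ V) p q ≤T φ U p k₀ ⊗ φ V k₀ q
    attained = proj₂ (split (p ≤? q))

  φ-++ : ∀ (u v : Word n) → φ (u ++ v) ≈M (φ u ⊗M φ v)
  φ-++ []      v       p q = sym (⊗M-identityˡ (φ v) p q)
  φ-++ (a ∷ u) []      p q rewrite ++-identityʳ u = sym (⊗M-identityʳ (φ (a ∷ u)) p q)
  φ-++ (a ∷ u) (b ∷ v)     = φ-++-∷ a u b v

  φ-++-cong : ∀ {u v : Word n} → φ u ≈M φ v → ∀ a b → φ (a ++ u ++ b) ≈M φ (a ++ v ++ b)
  φ-++-cong {u} {v} u≈v a b p q = begin
    φ (a ++ u ++ b) p q          ≡⟨ φ-++ a (u ++ b) p q ⟩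
    (φ a ⊗M φ (u ++ b)) p q      ≡⟨ ⊗M-congʳ (φ a) ub≈vb p q ⟩
    (φ a ⊗M φ (v ++ b)) p q      ≡⟨ φ-++ a (v ++ b) p q ⟨
    φ (a ++ v ++ b) p q          ∎
    where
    open ≡-Reasoning
    ub≈vb : φ (u ++ b) ≈M φ (v ++ b)
    ub≈vb r s = begin
      φ (u ++ b) r s             ≡⟨ φ-++ u b r s ⟩
      (φ u ⊗M φ b) r s           ≡⟨ ⊗M-congˡ (φ b) u≈v r s ⟩
      (φ v ⊗M φ b) r s           ≡⟨ φ-++ v b r s ⟨
      φ (v ++ b) r s             ∎

  φ-knuth : ∀ {u v : Word n} → KnuthRel u v → φ u ≈M φ v
  φ-knuth (knuth₁ x≤y y<z) = φ-∷-≈ (λ p q → longest-knuth₁ p q x≤y y<z)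
  φ-knuth (knuth₂ x<y y≤z) = φ-∷-≈ (λ p q → longest-knuth₂ p q x<y y≤z)

  φ-plac : ∀ {u v : Word n} → u ≡plac v → φ u ≈M φ v
  φ-plac (plac-step a b k)  = φ-++-cong (φ-knuth k) a b
  φ-plac plac-refl          p q = refl
  φ-plac (plac-sym u≡v)     p q = sym (φ-plac u≡v p q)
  φ-plac (plac-trans u≡v v≡w) p q = trans (φ-plac u≡v p q) (φ-plac v≡w p q)

  φ-upperTriangular : ∀ (w : Word n) → UpperTriangular (φ w)
  φ-upperTriangular []      p q q<p with p ≟ q
  ... | yes refl = ⊥-elim (ℕ.<-irrefl refl q<p)
  ... | no _     = refl
  φ-upperTriangular (a ∷ w) p q q<p = φ-∷-≰ a w (ℕ.<⇒≱ q<p)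

lemma5p2 : (n : ℕ) → n ≥ 1 →
    ((u v : Word n) → u ≡plac v → φ u ≈M φ v)
    × ((u : Word n) → UpperTriangular (φ u))
    × (φ {n} [] ≈M IdM)
    × ((u v : Word n) → φ (u ++ v) ≈M (φ u ⊗M φ v))
lemma5p2 n _ = (λ u v → φ-plac) , φ-upperTriangular , (λ p q → refl) , φ-++
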